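{- Let $S=\{a_n: n\in\mathbb{N}\}$ where $(a_n)$ is a sequence of natural numbers with $a_{k+2}-a_{k+1}>a_{k+1}-a_k>0$ for every $k\in\mathbb{N}$. Then $S$ is pseudoloose if and only if $S$ is loose.
   Context: For $S\subseteq\mathbb{N}$ and $m\in S$, $\delta_S(m)=m'-m$ where $m'$ is the least element of $S$ greater than $m$ ($\infty$ if none); for $n,t\in\mathbb{Z}_+$, $\gamma_S(n,t)=|\{m\in S:\delta_S(m)\ge t,\ m+t<n\}|$. For $\varepsilon>0$, $S$ is $\varepsilon$-loose relative to $n$ if there exists $t\in\mathbb{Z}_+$ with $t\gamma_S(n,t)\ge\varepsilon n$ and $n^\varepsilon\le t\le n^{1-\varepsilon}$. $S$ is loose if there is $\varepsilon>0$ such that for all but finitely many $n\in\mathbb{Z}_+$, $S$ is $\varepsilon$-loose relative to $n$. For $\chi\colon\mathbb{N}\to\{0,1\}$ and $w\in\{0,1\}^s$, $T^\chi_w=\{m\in\mathbb{N}:\chi(m+i)=w(i)\text{ for all }i<s\}$. $S$ is pseudoloose if there is $\varepsilon>0$ such that for all but finitely many $n\in\mathbb{Z}_+$ there is $w\in\{0,1\}^s$ with $s\le n^{1-\varepsilon}$ such that $T^{\chi_S}_w$ is $\varepsilon$-loose relative to $n$, where $\chi_S$ is the characteristic function of $S$. -}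

module Defs where

open import Data.Nat using (ℕ; zero; suc; _+_; _*_; _∸_; _^_; _≤_; _<_; _≡ᵇ_; _<ᵇ_)
open import Data.Bool using (Bool; true; false; _∧_; not; if_then_else_)
open import Data.List using (List; []; _∷_; length; upTo; map)
open import Data.Nat.ListAction using (sum)
open import Data.Bool.ListAction using (all; any)
open import Data.Product using (Σ; ∃; _×_; _,_)

-- Sets of naturals are represented by their characteristic functions χ : ℕ → Bool.

_==_ : Bool → Bool → Bool
true  == b = b
false == b = not b

-- δ_S(m) ≥ t  (for m ∈ S, t ≥ 1): the least element of S greater than m
-- (∞ if none) is ≥ m + t, i.e. no element of S lies in m+1 .. m+t-1.
gapAtLeast : (ℕ → Bool) → ℕ → ℕ → Bool
gapAtLeast χ m t = all (λ j → not (χ (m + suc j))) (upTo (t ∸ 1))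

-- γ_S(n,t) = |{ m ∈ S : δ_S(m) ≥ t, m + t < n }|  (all such m are < n)
γ : (ℕ → Bool) → ℕ → ℕ → ℕ
γ χ n t = sum (map (λ m → if χ m ∧ gapAtLeast χ m t ∧ ((m + t) <ᵇ n) then 1 else 0) (upTo n))

-- ε-loose relative to n, with ε = p / q (p, q ≥ 1):
--   ∃ t ≥ 1,  t·γ(n,t) ≥ ε n,  n^ε ≤ t,  t ≤ n^(1-ε)
-- with the real-exponent inequalities cleared of denominators:
--   n^(p/q) ≤ t  ⇔  n^p ≤ t^q ;   t ≤ n^(1 - p/q)  ⇔  t^q · n^p ≤ n^q.
LooseRel : ℕ → ℕ → (ℕ → Bool) → ℕ → Set
LooseRel p q χ n =
  Σ ℕ λ t → (1 ≤ t) × (p * n ≤ q * (t * γ χ n t)) × (n ^ p ≤ t ^ q) × (t ^ q * n ^ p ≤ n ^ q)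

Loose : (ℕ → Bool) → Set
Loose χ = Σ ℕ λ p → Σ ℕ λ q → (1 ≤ p) × (1 ≤ q) ×
  Σ ℕ λ N → (n : ℕ) → N < n → 1 ≤ n → LooseRel p q χ n

-- T^χ_w = { m : χ(m+i) = w(i) for all i < s },  s = length w.
matchesAt : (ℕ → Bool) → List Bool → ℕ → Bool
matchesAt χ []       m = true
matchesAt χ (b ∷ w) m = (χ m == b) ∧ matchesAt χ w (suc m)

T : (ℕ → Bool) → List Bool → (ℕ → Bool)
T χ w m = matchesAt χ w m

-- S is pseudoloose: ∃ ε > 0 such that for all but finitely many positive n there is
-- w ∈ {0,1}^s with s ≤ n^(1-ε) (i.e. s^q · n^p ≤ n^q) and T^χ_w ε-loose relative to n.
Pseudoloose : (ℕ → Bool) → Set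
Pseudoloose χ = Σ ℕ λ p → Σ ℕ λ q → (1 ≤ p) × (1 ≤ q) ×
  Σ ℕ λ N → (n : ℕ) → N < n → 1 ≤ n →
    Σ (List Bool) λ w → (length w ^ q * n ^ p ≤ n ^ q) × LooseRel p q (T χ w) n

-- characteristic function of the range {a k : k ∈ ℕ} of a sequence; for a strictly
-- increasing sequence a k ≥ k, so m is in the range iff m = a k for some k ≤ m.
rangeχ : (ℕ → ℕ) → ℕ → Bool
rangeχ a m = any (λ k → a k ≡ᵇ m) (upTo (suc m))

{-# OPTIONS --safe #-}
module Submission where

-- A loose set is pseudoloose through the one-letter pattern 1, whose occurrence set is the set itself.
-- Conversely, fix a pattern w of length s, t ≥ 2, and a gap start m of the occurrence set T_w, i.e. an
-- occurrence with no other one less than t later. If w has no 1, its zeros are followed by an element of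
-- S at m + s (otherwise m + 1 would be an occurrence too); if w has a single 1, at position i, there is an
-- element at m + i. Unless this element is a 0 (true for at most one m), it is a (k + 1) for some k, and the
-- zeros before it make the preceding gap larger than s (resp. i). As gaps increase, the gap after a (k + 1)
-- is larger still, so w occurs again, at m + s + 1 (resp. m + that gap). This occurrence is at least t
-- after m, so the gap after a (k + 1) is at least t: gap starts of T_w map injectively to gap starts of S,
-- shifted by at most s. If w has two 1s, the first two mark consecutive elements of S at a fixed distance,
-- and as the gaps are distinct T_w has at most one element. Counting gives
-- t γ_{T_w}(n, t) ≤ t γ_S(n, t) + s + 3t, and since s, t ≤ n^(1-ε), for large n the error is absorbed by
-- passing from ε to ε / 2.

-- The occurrence set T χ w of Defs is written matchesAt χ w; T is the truth predicate on Bool.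
open import Defs hiding (T)

open import Algebra.Properties.CommutativeSemigroup using (interchange)
open import Data.Bool using (Bool; true; false; T; not; _∧_; if_then_else_)
open import Data.Bool.ListAction using (all; and)
open import Data.Bool.Properties using (T-∧; ∧-identityʳ)
open import Data.List using (List; []; _∷_; _++_; replicate; length; map; upTo; applyUpTo)
open import Data.List.Membership.Propositional using (lose)
open import Data.List.Membership.Propositional.Properties using (∈-upTo⁺; ∈-upTo⁻)
open import Data.List.Properties using (map-cong; length-++; length-replicate; ++-identityʳ)
import Data.List.Relation.Unary.All as All
open import Data.List.Relation.Unary.All.Properties using (all⁺; all⁻)
open import Data.List.Relation.Unary.Any using (satisfied)
open import Data.List.Relation.Unary.Any.Properties using (any⁺; any⁻)
open import Data.Nat
open import Data.Nat.ListAction using (sum)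
open import Data.Nat.Properties
open import Data.Nat.Tactic.RingSolver using (solve-∀)
open import Data.Product as × using (Σ; ∃; _×_; _,_; proj₁; proj₂)
open import Data.Sum as ⊎ using (_⊎_; inj₁; inj₂)
open import Data.Unit using (tt)
open import Function using (_∘_; id; _⇔_; Equivalence; mk⇔)
open import Relation.Binary.PropositionalEquality
open import Relation.Nullary using (¬_; yes; no; contradiction)
open import Relation.Nullary.Decidable using (T?; decidable-stable)

private variable
  p χ χ′ : ℕ → Bool
  b b′ b″ : Bool
  d i k l l′ m n r s t u u′ x y N : ℕ

-- Counting

𝟙 : Bool → ℕ
𝟙 b = if b then 1 else 0

𝟙-false : ¬ T b → 𝟙 b ≡ 0
𝟙-false {false} _ = refl
𝟙-false {true}  h = contradiction tt h

𝟙-true : T b → 𝟙 b ≡ 1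
𝟙-true {true} _ = refl

𝟙-mono : (T b → T b′) → 𝟙 b ≤ 𝟙 b′
𝟙-mono {false} _ = z≤n
𝟙-mono {true}  h = ≤-reflexive (sym (𝟙-true (h tt)))

𝟙-⊎ : (T b → T b′ ⊎ T b″) → 𝟙 b ≤ 𝟙 b′ + 𝟙 b″
𝟙-⊎ {false} _ = z≤n
𝟙-⊎ {true} {b′} {b″} h with h tt
... | inj₁ tb′ = ≤-trans (≤-reflexive (sym (𝟙-true tb′))) (m≤m+n (𝟙 b′) (𝟙 b″))
... | inj₂ tb″ = ≤-trans (≤-reflexive (sym (𝟙-true tb″))) (m≤n+m (𝟙 b″) (𝟙 b′))

count : (ℕ → Bool) → ℕ → ℕ
count p zero    = 0
count p (suc n) = 𝟙 (p 0) + count (p ∘ suc) n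

sum-map-applyUpTo : ∀ (p : ℕ → Bool) (g : ℕ → ℕ) n → sum (map (𝟙 ∘ p) (applyUpTo g n)) ≡ count (p ∘ g) n
sum-map-applyUpTo p g zero    = refl
sum-map-applyUpTo p g (suc n) = cong (𝟙 (p (g 0)) +_) (sum-map-applyUpTo p (g ∘ suc) n)

count-++ : ∀ p i n → count p (i + n) ≡ count p i + count (λ x → p (i + x)) n
count-++ p zero    n = refl
count-++ p (suc i) n = trans (cong (𝟙 (p 0) +_) (count-++ (p ∘ suc) i n)) (sym (+-assoc (𝟙 (p 0)) _ _))

count-monoʳ : ∀ p → m ≤ n → count p m ≤ count p n
count-monoʳ {m} {n} p m≤n = begin
  count p m                                   ≤⟨ m≤m+n _ _ ⟩
  count p m + count (λ x → p (m + x)) (n ∸ m) ≡⟨ count-++ p m (n ∸ m) ⟨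
  count p (m + (n ∸ m))                       ≡⟨ cong (count p) (m+[n∸m]≡n m≤n) ⟩
  count p n                                   ∎
  where open ≤-Reasoning

count-mono : ∀ p q → (∀ {x} → x < n → T (p x) → T (q x)) → count p n ≤ count q n
count-mono {zero}  p q h = z≤n
count-mono {suc n} p q h = +-mono-≤ (𝟙-mono (h z<s)) (count-mono (p ∘ suc) (q ∘ suc) (h ∘ s<s))

count-⊎ : ∀ p q r → (∀ {x} → x < n → T (p x) → T (q x) ⊎ T (r x)) → count p n ≤ count q n + count r n
count-⊎ {zero}  p q r h = z≤n
count-⊎ {suc n} p q r h = begin
  𝟙 (p 0) + count (p ∘ suc) n
    ≤⟨ +-mono-≤ (𝟙-⊎ (h z<s)) (count-⊎ (p ∘ suc) (q ∘ suc) (r ∘ suc) (h ∘ s<s)) ⟩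
  (𝟙 (q 0) + 𝟙 (r 0)) + (count (q ∘ suc) n + count (r ∘ suc) n)
    ≡⟨ interchange +-commutativeSemigroup (𝟙 (q 0)) _ _ _ ⟩
  (𝟙 (q 0) + count (q ∘ suc) n) + (𝟙 (r 0) + count (r ∘ suc) n) ∎
  where open ≤-Reasoning

count-none : ∀ p n → (∀ {x} → x < n → ¬ T (p x)) → count p n ≡ 0
count-none p zero    _     = refl
count-none p (suc n) empty = cong₂ _+_ (𝟙-false (empty z<s)) (count-none (p ∘ suc) n (empty ∘ s<s))

AtMostOne : (ℕ → Bool) → Set
AtMostOne p = ∀ {x y} → T (p x) → T (p y) → x ≡ y

count-atMostOne : ∀ p n → AtMostOne p → count p n ≤ 1
count-atMostOne p zero    _   = z≤n
count-atMostOne p (suc n) one with T? (p 0)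
... | yes p0 = ≤-reflexive (cong₂ _+_ (𝟙-true p0) (count-none (p ∘ suc) n λ _ p1+x → 0≢1+n (one p0 p1+x)))
... | no ¬p0 = begin
  𝟙 (p 0) + count (p ∘ suc) n ≡⟨ cong (_+ count (p ∘ suc) n) (𝟙-false ¬p0) ⟩
  count (p ∘ suc) n           ≤⟨ count-atMostOne (p ∘ suc) n (λ px py → suc-injective (one px py)) ⟩
  1                           ∎
  where open ≤-Reasoning

Spaced : ℕ → (ℕ → Bool) → Set
Spaced t p = ∀ {x y} → T (p x) → x < y → y < x + t → ¬ T (p y)

Spaced-shift : ∀ c → Spaced t p → Spaced t (λ x → p (c + x))
Spaced-shift {t} c spaced {x} {y} px x<y y<x+t =
  spaced px (+-monoʳ-< c x<y) (subst (c + y <_) (sym (+-assoc c x t)) (+-monoʳ-< c y<x+t))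

-- Generalised by an empty initial segment of length d, so that the induction on L is structural.
count-spaced′ : ∀ L → Spaced t p → d ≤ t → (∀ {x} → x < d → ¬ T (p x)) → t * count p L + d ≤ L + t
count-spaced′ {t} {p} {d} zero _ d≤t _ = subst (λ z → z + d ≤ t) (sym (*-zeroʳ t)) d≤t
count-spaced′ {t} {p} {d} (suc L) spaced d≤t empty with T? (p 0)
count-spaced′ {t} {p} {suc d} (suc L) spaced d≤t empty | yes p0 = contradiction p0 (empty z<s)
count-spaced′ {zero} {p} {zero} (suc L) spaced d≤t empty | yes p0 = z≤n
count-spaced′ {suc t} {p} {zero} (suc L) spaced d≤t empty | yes p0 = begin
  suc t * (𝟙 (p 0) + c) + 0 ≡⟨ +-identityʳ _ ⟩
  suc t * (𝟙 (p 0) + c)     ≡⟨ cong (λ z → suc t * (z + c)) (𝟙-true p0) ⟩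
  suc t * suc c             ≡⟨ *-suc (suc t) c ⟩
  suc t + suc t * c         ≡⟨ cong suc (+-comm t (suc t * c)) ⟩
  suc (suc t * c + t)       ≤⟨ s≤s (count-spaced′ L (Spaced-shift 1 spaced) (n≤1+n t)
                                 (λ x<t → spaced p0 z<s (s<s x<t))) ⟩
  suc L + suc t             ∎
  where
  open ≤-Reasoning
  c = count (p ∘ suc) L
count-spaced′ {t} {p} {d} (suc L) spaced d≤t empty | no ¬p0 =
  subst (λ z → t * (z + count (p ∘ suc) L) + d ≤ suc L + t) (sym (𝟙-false ¬p0)) (rest d d≤t empty)
  where
  rest : ∀ d → d ≤ t → (∀ {x} → x < d → ¬ T (p x)) → t * count (p ∘ suc) L + d ≤ suc L + t
  rest zero    _   _     = m≤n⇒m≤1+n (count-spaced′ L (Spaced-shift 1 spaced) z≤n λ ())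
  rest (suc d) d<t empty = begin
    t * count (p ∘ suc) L + suc d   ≡⟨ +-suc _ d ⟩
    suc (t * count (p ∘ suc) L + d) ≤⟨ s≤s (count-spaced′ L (Spaced-shift 1 spaced) (<⇒≤ d<t) (empty ∘ s<s)) ⟩
    suc L + t                       ∎
    where open ≤-Reasoning

count-spaced : ∀ L → Spaced t p → t * count p L ≤ L + t
count-spaced {t} L spaced = subst (_≤ L + t) (+-identityʳ _) (count-spaced′ L spaced z≤n λ ())

-- Gap starts

T-not⇒¬T : T (not b) → ¬ T b
T-not⇒¬T {true} ()

¬T⇒T-not : ¬ T b → T (not b)
¬T⇒T-not {false} _ = tt
¬T⇒T-not {true}  h = h tt

NoneIn : (ℕ → Bool) → ℕ → ℕ → Set
NoneIn χ l u = ∀ {x} → l ≤ x → x < u → ¬ T (χ x)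

NoneIn-⊆ : l ≤ l′ → u′ ≤ u → NoneIn χ l u → NoneIn χ l′ u′
NoneIn-⊆ l≤l′ u′≤u none l′≤x x<u′ = none (≤-trans l≤l′ l′≤x) (<-≤-trans x<u′ u′≤u)

NoneIn-∷ : ¬ T (χ l) → NoneIn χ (suc l) u → NoneIn χ l u
NoneIn-∷ ¬χl none l≤x x<u with m≤n⇒m<n∨m≡n l≤x
... | inj₁ l<x  = none l<x x<u
... | inj₂ refl = ¬χl

NoneIn-∷ʳ : NoneIn χ l u → ¬ T (χ u) → NoneIn χ l (suc u)
NoneIn-∷ʳ none ¬χu l≤x x<1+u with m≤n⇒m<n∨m≡n (s≤s⁻¹ x<1+u)
... | inj₁ x<u  = none l≤x x<u
... | inj₂ refl = ¬χu

GapStart : (ℕ → Bool) → ℕ → ℕ → ℕ → Set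
GapStart χ N t m = T (χ m) × NoneIn χ (suc m) (m + t) × m + t < N

isGapStart : (ℕ → Bool) → ℕ → ℕ → ℕ → Bool
isGapStart χ N t m = χ m ∧ gapAtLeast χ m t ∧ (m + t <ᵇ N)

γ≡count : ∀ χ n t → γ χ n t ≡ count (isGapStart χ n t) n
γ≡count χ n t = sum-map-applyUpTo (isGapStart χ n t) id n

T-gapAtLeast : ∀ χ t → T (gapAtLeast χ m t) ⇔ NoneIn χ (suc m) (m + t)
T-gapAtLeast {m} χ zero = mk⇔
  (λ _ {x} 1+m≤x x<m+0 → contradiction (<⇒≤ 1+m≤x) (<⇒≱ (subst (x <_) (+-identityʳ m) x<m+0))) _
T-gapAtLeast {m} χ (suc t) = mk⇔ to from
  where
  notAfter : ℕ → Bool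
  notAfter j = not (χ (m + suc j))
  to : T (all notAfter (upTo t)) → NoneIn χ (suc m) (m + suc t)
  to h {x} 1+m≤x x<m+1+t =
    T-not⇒¬T (subst (T ∘ not ∘ χ) m+1+o≡x (All.lookup (all⁺ notAfter _ h) (∈-upTo⁺ o<t)))
    where
    o = x ∸ suc m
    m+1+o≡x : m + suc o ≡ x
    m+1+o≡x = trans (+-suc m o) (m+[n∸m]≡n 1+m≤x)
    o<t : o < t
    o<t = s<s⁻¹ (+-cancelˡ-< m (suc o) (suc t) (subst (_< m + suc t) (sym m+1+o≡x) x<m+1+t))
  from : NoneIn χ (suc m) (m + suc t) → T (all notAfter (upTo t))
  from none = all⁻ notAfter (All.tabulate λ {j} j∈ → ¬T⇒T-not
    (none (≤-trans (s≤s (m≤m+n m j)) (≤-reflexive (sym (+-suc m j)))) (+-monoʳ-< m (s<s (∈-upTo⁻ j∈)))))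

T-isGapStart : ∀ χ N → T (isGapStart χ N t m) ⇔ GapStart χ N t m
T-isGapStart {t} {m} χ N = mk⇔ to from
  where
  to : T (isGapStart χ N t m) → GapStart χ N t m
  to h with Equivalence.to T-∧ h
  ... | χm , rest with Equivalence.to (T-∧ {gapAtLeast χ m t}) rest
  ... | gap , lt = χm , Equivalence.to (T-gapAtLeast χ t) gap , <ᵇ⇒< (m + t) N lt
  from : GapStart χ N t m → T (isGapStart χ N t m)
  from (χm , none , lt) =
    Equivalence.from T-∧ (χm , Equivalence.from T-∧ (Equivalence.from (T-gapAtLeast χ t) none , <⇒<ᵇ lt))

gapStart-reaches : GapStart χ N t m → T (χ y) → m < y → m + t ≤ y
gapStart-reaches (_ , none , _) χy m<y = ≮⇒≥ λ y<m+t → none m<y y<m+t χy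

isGapStart-spaced : ∀ χ N t → Spaced t (isGapStart χ N t)
isGapStart-spaced χ N t px x<y y<x+t py =
  proj₁ (proj₂ (Equivalence.to (T-isGapStart χ N) px)) x<y y<x+t (proj₁ (Equivalence.to (T-isGapStart χ N) py))

m<n∸o⇒m+o<n : x < n ∸ t → x + t < n
m<n∸o⇒m+o<n {x} {n} {t} x<n∸t with t ≤? n
... | yes t≤n = m≤o∸n⇒m+n≤o (suc x) t≤n x<n∸t
... | no  t≰n = contradiction (subst (x <_) (m≤n⇒m∸n≡0 (<⇒≤ (≰⇒> t≰n))) x<n∸t) n≮0

gapStarts-beyond-horizon : ∀ χ i n t →
  t * count (isGapStart χ (i + n) t) (i + n) ≤ t * γ χ n t + (i + 2 * t)
gapStarts-beyond-horizon χ i n t = begin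
  t * count G (i + n)                                 ≤⟨ *-monoʳ-≤ t (count-monoʳ G i+n≤c+[t+i]) ⟩
  t * count G (c + (t + i))                           ≡⟨ cong (t *_) (count-++ G c (t + i)) ⟩
  t * (count G c + count (λ x → G (c + x)) (t + i))   ≡⟨ *-distribˡ-+ t _ _ ⟩
  t * count G c + t * count (λ x → G (c + x)) (t + i) ≤⟨ +-mono-≤ (*-monoʳ-≤ t before-horizon) window ⟩
  t * γ χ n t + (t + i + t)                           ≡⟨ cong (t * γ χ n t +_) (rearrange t i) ⟩
  t * γ χ n t + (i + 2 * t)                           ∎
  where
  open ≤-Reasoning
  G = isGapStart χ (i + n) t
  c = n ∸ t
  rearrange : ∀ t i → t + i + t ≡ i + 2 * t
  rearrange = solve-∀
  i+n≤c+[t+i] : i + n ≤ c + (t + i)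
  i+n≤c+[t+i] = ≤-trans (+-monoʳ-≤ i (m≤n+m∸n n t)) (≤-reflexive (rotate i t c))
    where
    rotate : ∀ i t c → i + (t + c) ≡ c + (t + i)
    rotate = solve-∀
  shrink-horizon : x + t < n → T (G x) → T (isGapStart χ n t x)
  shrink-horizon x+t<n Gx with Equivalence.to (T-isGapStart χ (i + n)) Gx
  ... | χx , none , _ = Equivalence.from (T-isGapStart χ n) (χx , none , x+t<n)
  before-horizon : count G c ≤ γ χ n t
  before-horizon = begin
    count G c                    ≤⟨ count-mono G (isGapStart χ n t) (shrink-horizon ∘ m<n∸o⇒m+o<n) ⟩
    count (isGapStart χ n t) c   ≤⟨ count-monoʳ (isGapStart χ n t) (m∸n≤m n t) ⟩
    count (isGapStart χ n t) n   ≡⟨ γ≡count χ n t ⟨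
    γ χ n t                      ∎
  window : t * count (λ x → G (c + x)) (t + i) ≤ t + i + t
  window = count-spaced (t + i) (Spaced-shift c (isGapStart-spaced χ (i + n) t))

record GapStartEmbedding (χ′ χ : ℕ → Bool) (n t : ℕ) : Set where
  field
    shift       : ℕ
    exception   : ℕ → Bool
    atMostOne   : AtMostOne exception
    embed       : GapStart χ′ n t m → GapStart χ (shift + n) t (shift + m) ⊎ T (exception m)

γ-embedding : (E : GapStartEmbedding χ′ χ n t) →
  t * γ χ′ n t ≤ t * γ χ n t + (GapStartEmbedding.shift E + 3 * t)
γ-embedding {χ′} {χ} {n} {t} E = begin
  t * γ χ′ n t                             ≡⟨ cong (t *_) (γ≡count χ′ n t) ⟩
  t * count (isGapStart χ′ n t) n          ≤⟨ *-monoʳ-≤ t (count-⊎ _ G-shifted exception split) ⟩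
  t * (count G-shifted n + count exception n)
    ≤⟨ *-monoʳ-≤ t (+-mono-≤ unshift (count-atMostOne exception n atMostOne)) ⟩
  t * (count G (shift + n) + 1)            ≡⟨ *-distribˡ-+ t _ 1 ⟩
  t * count G (shift + n) + t * 1
    ≤⟨ +-mono-≤ (gapStarts-beyond-horizon χ shift n t) (≤-reflexive (*-identityʳ t)) ⟩
  t * γ χ n t + (shift + 2 * t) + t        ≡⟨ rearrange (t * γ χ n t) shift t ⟩
  t * γ χ n t + (shift + 3 * t)            ∎
  where
  open ≤-Reasoning
  open GapStartEmbedding E
  G = isGapStart χ (shift + n) t
  G-shifted : ℕ → Bool
  G-shifted m = G (shift + m)
  split : x < n → T (isGapStart χ′ n t x) → T (G-shifted x) ⊎ T (exception x)
  split _ g = ⊎.map₁ (Equivalence.from (T-isGapStart χ (shift + n))) (embed (Equivalence.to (T-isGapStart χ′ n) g))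
  unshift : count G-shifted n ≤ count G (shift + n)
  unshift = ≤-trans (m≤n+m _ (count G shift)) (≤-reflexive (sym (count-++ G shift n)))
  rearrange : ∀ X s t → X + (s + 2 * t) + t ≡ X + (s + 3 * t)
  rearrange = solve-∀

gapAtLeast-cong : χ ≗ χ′ → ∀ m t → gapAtLeast χ m t ≡ gapAtLeast χ′ m t
gapAtLeast-cong χ≗χ′ m t = cong and (map-cong (λ j → cong not (χ≗χ′ (m + suc j))) (upTo (t ∸ 1)))

γ-cong : χ ≗ χ′ → ∀ n t → γ χ n t ≡ γ χ′ n t
γ-cong χ≗χ′ n t = cong sum (map-cong
  (λ m → cong 𝟙 (cong₂ _∧_ (χ≗χ′ m) (cong (_∧ (m + t <ᵇ n)) (gapAtLeast-cong χ≗χ′ m t))))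
  (upTo n))

-- Occurrences of a pattern

==-true : ∀ b → (b == true) ≡ b
==-true true  = refl
==-true false = refl

==-false : ∀ b → (b == false) ≡ not b
==-false true  = refl
==-false false = refl

matchesAt-[true] : ∀ χ → matchesAt χ (true ∷ []) ≗ χ
matchesAt-[true] χ m = trans (∧-identityʳ _) (==-true (χ m))

matchesAt-true⁻ : ∀ χ w → T (matchesAt χ (true ∷ w) m) → T (χ m) × T (matchesAt χ w (suc m))
matchesAt-true⁻ {m} χ w h = ×.map₁ (subst T (==-true (χ m))) (Equivalence.to T-∧ h)

matchesAt-true⁺ : ∀ χ w → T (χ m) → T (matchesAt χ w (suc m)) → T (matchesAt χ (true ∷ w) m)
matchesAt-true⁺ {m} χ w χm h = Equivalence.from T-∧ (subst T (sym (==-true (χ m))) χm , h)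

matchesAt-falses-++⁻ : ∀ χ i w → T (matchesAt χ (replicate i false ++ w) m) →
  NoneIn χ m (i + m) × T (matchesAt χ w (i + m))
matchesAt-falses-++⁻ χ zero w h = (λ m≤x x<m → contradiction m≤x (<⇒≱ x<m)) , h
matchesAt-falses-++⁻ {m} χ (suc i) w h with Equivalence.to T-∧ h
... | ¬χm , rest with matchesAt-falses-++⁻ χ i w rest
... | none , matched =
  NoneIn-∷ (T-not⇒¬T (subst T (==-false (χ m)) ¬χm)) (subst (NoneIn χ (suc m)) (+-suc i m) none) ,
  subst (T ∘ matchesAt χ w) (+-suc i m) matched

matchesAt-falses-++⁺ : ∀ χ i w → NoneIn χ m (i + m) → T (matchesAt χ w (i + m)) →
  T (matchesAt χ (replicate i false ++ w) m)
matchesAt-falses-++⁺ χ zero w _ matched = matched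
matchesAt-falses-++⁺ {m} χ (suc i) w none matched = Equivalence.from T-∧
  ( subst T (sym (==-false (χ m))) (¬T⇒T-not (none ≤-refl (s≤s (m≤n+m m i))))
  , matchesAt-falses-++⁺ χ i w (NoneIn-⊆ (n≤1+n m) (≤-reflexive (+-suc i m)) none)
                           (subst (T ∘ matchesAt χ w) (sym (+-suc i m)) matched))

matchesAt-falses⁻ : ∀ χ i → T (matchesAt χ (replicate i false) m) → NoneIn χ m (i + m)
matchesAt-falses⁻ {m} χ i h =
  proj₁ (matchesAt-falses-++⁻ χ i [] (subst (λ w → T (matchesAt χ w m)) (sym (++-identityʳ (replicate i false))) h))

matchesAt-falses⁺ : ∀ χ i → NoneIn χ m (i + m) → T (matchesAt χ (replicate i false) m)
matchesAt-falses⁺ {m} χ i none =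
  subst (λ w → T (matchesAt χ w m)) (++-identityʳ (replicate i false)) (matchesAt-falses-++⁺ χ i [] none tt)

loose⇒pseudoloose : ∀ χ → Loose χ → Pseudoloose χ
loose⇒pseudoloose χ (p , q , 1≤p , 1≤q , N , loose) =
  p , q , 1≤p , 1≤q , N , λ n N<n 1≤n → singleton (loose n N<n 1≤n)
  where
  singleton : LooseRel p q χ n →
    Σ (List Bool) λ w → (length w ^ q * n ^ p ≤ n ^ q) × LooseRel p q (matchesAt χ w) n
  singleton {n} (t , 1≤t , dense , lower , upper) =
    true ∷ [] , ≤-trans (*-monoˡ-≤ (n ^ p) (^-monoˡ-≤ q 1≤t)) upper ,
    t , 1≤t , subst (λ g → p * n ≤ q * (t * g)) (γ-cong (sym ∘ matchesAt-[true] χ) n t) dense , lower , upper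

data Trues : List Bool → Set where
  allFalse : ∀ s → Trues (replicate s false)
  oneTrue  : ∀ i r → Trues (replicate i false ++ true ∷ replicate r false)
  twoTrues : ∀ i j v → Trues (replicate i false ++ true ∷ replicate j false ++ true ∷ v)

trues : ∀ w → Trues w
trues []          = allFalse 0
trues (false ∷ w) with trues w
... | allFalse s     = allFalse (suc s)
... | oneTrue i r    = oneTrue (suc i) r
... | twoTrues i j v = twoTrues (suc i) j v
trues (true ∷ w) with trues w
... | allFalse r     = oneTrue 0 r
... | oneTrue j r    = twoTrues 0 j (replicate r false)
... | twoTrues j k v = twoTrues 0 j (replicate k false ++ true ∷ v)

-- Exponent arithmetic

1≤m^n : ∀ q → 1 ≤ m → 1 ≤ m ^ q
1≤m^n {m} q 1≤m = subst (_≤ m ^ q) (^-zeroˡ q) (^-monoˡ-≤ q 1≤m)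

m≤m^n : ∀ p → 1 ≤ p → 1 ≤ m → m ≤ m ^ p
m≤m^n {m} (suc p) _ 1≤m = m≤m*n m (m ^ p) {{>-nonZero (1≤m^n p 1≤m)}}

^-distribʳ-* : ∀ m n q → (m * n) ^ q ≡ m ^ q * n ^ q
^-distribʳ-* m n zero    = refl
^-distribʳ-* m n (suc q) = trans (cong (m * n *_) (^-distribʳ-* m n q)) (interchange *-commutativeSemigroup m n (m ^ q) (n ^ q))

^-double : ∀ m q → m ^ (2 * q) ≡ m ^ q * m ^ q
^-double m q = trans (^-distribˡ-+-* m q (q + 0)) (cong (λ e → m ^ q * m ^ e) (+-identityʳ q))

^-cancelʳ-≤ : ∀ q → 1 ≤ q → m ^ q ≤ n ^ q → m ≤ n
^-cancelʳ-≤ (suc q) _ m^q≤n^q = ≮⇒≥ λ n<m → <⇒≱ (^-monoˡ-< (suc q) n<m) m^q≤n^q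

2≤-from-exponents : ∀ p q → 1 ≤ p → 1 < n → n ^ p ≤ t ^ q → 2 ≤ t
2≤-from-exponents {n} {t} p q 1≤p 1<n n^p≤t^q = ≰⇒> λ t≤1 → <⇒≱ 1<n (begin
  n          ≤⟨ m≤m^n p 1≤p (<⇒≤ 1<n) ⟩
  n ^ p      ≤⟨ n^p≤t^q ⟩
  t ^ q      ≤⟨ ^-monoˡ-≤ q t≤1 ⟩
  1 ^ q      ≡⟨ ^-zeroˡ q ⟩
  1          ∎)
  where open ≤-Reasoning

-- x ≤ n ^ (1 - p/q) together with c ≤ n ^ (p/q) gives c x ≤ n.
≤-from-exponents : ∀ {c} p q → 1 ≤ q → c ^ q ≤ n ^ p → x ^ q * n ^ p ≤ n ^ q → c * x ≤ n
≤-from-exponents {n = n} {x = x} {c = c} p q 1≤q c^q≤n^p x^q*n^p≤n^q = ^-cancelʳ-≤ q 1≤q (begin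
  (c * x) ^ q     ≡⟨ ^-distribʳ-* c x q ⟩
  c ^ q * x ^ q   ≤⟨ *-monoˡ-≤ (x ^ q) c^q≤n^p ⟩
  n ^ p * x ^ q   ≡⟨ *-comm (n ^ p) (x ^ q) ⟩
  x ^ q * n ^ p   ≤⟨ x^q*n^p≤n^q ⟩
  n ^ q           ∎)
  where open ≤-Reasoning

-- The window n ^ ε ≤ t ≤ n ^ (1 - ε) for ε = p / q contains the one for ε / 2.
halve-window : ∀ p q → 1 ≤ t → 1 ≤ n → n ^ p ≤ t ^ q → t ^ q * n ^ p ≤ n ^ q →
  n ^ p ≤ t ^ (2 * q) × t ^ (2 * q) * n ^ p ≤ n ^ (2 * q)
halve-window {t} {n} p q 1≤t 1≤n n^p≤t^q t^q*n^p≤n^q = lower , upper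
  where
  open ≤-Reasoning
  lower : n ^ p ≤ t ^ (2 * q)
  lower = begin
    n ^ p           ≤⟨ n^p≤t^q ⟩
    t ^ q           ≤⟨ m≤m*n (t ^ q) (t ^ q) {{>-nonZero (1≤m^n q 1≤t)}} ⟩
    t ^ q * t ^ q   ≡⟨ ^-double t q ⟨
    t ^ (2 * q)     ∎
  upper : t ^ (2 * q) * n ^ p ≤ n ^ (2 * q)
  upper = begin
    t ^ (2 * q) * n ^ p                 ≡⟨ cong (_* n ^ p) (^-double t q) ⟩
    t ^ q * t ^ q * n ^ p               ≤⟨ *-monoʳ-≤ (t ^ q * t ^ q) (m≤m*n (n ^ p) (n ^ p) {{>-nonZero (1≤m^n p 1≤n)}}) ⟩
    t ^ q * t ^ q * (n ^ p * n ^ p)     ≡⟨ interchange *-commutativeSemigroup (t ^ q) (t ^ q) (n ^ p) (n ^ p) ⟩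
    t ^ q * n ^ p * (t ^ q * n ^ p)     ≤⟨ *-mono-≤ t^q*n^p≤n^q t^q*n^p≤n^q ⟩
    n ^ q * n ^ q                       ≡⟨ ^-double n q ⟨
    n ^ (2 * q)                         ∎

absorb-error : ∀ {p q n X Y E} → 1 ≤ p → p * n ≤ q * Y → Y ≤ X + E → 2 * (q * E) ≤ n → p * n ≤ 2 * q * X
absorb-error {p} {q} {n} {X} {Y} {E} 1≤p pn≤qY Y≤X+E 2qE≤n = +-cancelʳ-≤ (p * n) (p * n) (2 * q * X) (begin
  p * n + p * n               ≡⟨ double (p * n) ⟩
  2 * (p * n)                 ≤⟨ *-monoʳ-≤ 2 (≤-trans pn≤qY (*-monoʳ-≤ q Y≤X+E)) ⟩
  2 * (q * (X + E))           ≡⟨ distribute q X E ⟩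
  2 * q * X + 2 * (q * E)     ≤⟨ +-monoʳ-≤ (2 * q * X) (≤-trans 2qE≤n (m≤m*n n p {{>-nonZero 1≤p}})) ⟩
  2 * q * X + n * p           ≡⟨ cong (2 * q * X +_) (*-comm n p) ⟩
  2 * q * X + p * n           ∎)
  where
  open ≤-Reasoning
  double : ∀ y → y + y ≡ 2 * y
  double = solve-∀
  distribute : ∀ q X E → 2 * (q * (X + E)) ≡ 2 * q * X + 2 * (q * E)
  distribute = solve-∀

-- Sequences with increasing gaps

StrictlyIncreasing : (ℕ → ℕ) → Set
StrictlyIncreasing f = ∀ k → f k < f (suc k)

module _ {f : ℕ → ℕ} (f-inc : StrictlyIncreasing f) where

  increasing-mono-< : k < l → f k < f l
  increasing-mono-< {k} {suc l} k<1+l with m≤n⇒m<n∨m≡n (s≤s⁻¹ k<1+l)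
  ... | inj₁ k<l  = <-trans (increasing-mono-< k<l) (f-inc l)
  ... | inj₂ refl = f-inc k

  increasing-mono-≤ : k ≤ l → f k ≤ f l
  increasing-mono-≤ k≤l with m≤n⇒m<n∨m≡n k≤l
  ... | inj₁ k<l  = <⇒≤ (increasing-mono-< k<l)
  ... | inj₂ refl = ≤-refl

  increasing-cancel-< : f k < f l → k < l
  increasing-cancel-< fk<fl = ≰⇒> λ l≤k → <⇒≱ fk<fl (increasing-mono-≤ l≤k)

  increasing-cancel-≤ : f k ≤ f l → k ≤ l
  increasing-cancel-≤ fk≤fl = ≮⇒≥ λ l<k → <⇒≱ (increasing-mono-< l<k) fk≤fl

  increasing-injective : f k ≡ f l → k ≡ l
  increasing-injective eq =
    ≤-antisym (increasing-cancel-≤ (≤-reflexive eq)) (increasing-cancel-≤ (≤-reflexive (sym eq)))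

  increasing-inflationary : ∀ k → k ≤ f k
  increasing-inflationary zero    = z≤n
  increasing-inflationary (suc k) = <-≤-trans (s≤s (increasing-inflationary k)) (f-inc k)

module IncreasingGaps (a : ℕ → ℕ) (a-inc : StrictlyIncreasing a)
  (gap-inc : StrictlyIncreasing (λ k → a (suc k) ∸ a k)) where

  S : ℕ → Bool
  S = rangeχ a

  gap : ℕ → ℕ
  gap k = a (suc k) ∸ a k

  a-suc : ∀ k → a (suc k) ≡ a k + gap k
  a-suc k = sym (m+[n∸m]≡n (<⇒≤ (a-inc k)))

  S-a : ∀ k → T (S (a k))
  S-a k = any⁺ _ (lose (∈-upTo⁺ (s≤s (increasing-inflationary a-inc k))) (≡⇒≡ᵇ (a k) (a k) refl))

  S⇒a : T (S x) → ∃ λ k → a k ≡ x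
  S⇒a {x} Sx with satisfied (any⁻ _ (upTo (suc x)) Sx)
  ... | k , ak≡ᵇx = k , ≡ᵇ⇒≡ (a k) x ak≡ᵇx

  first-or-successor : T (S x) → x ≡ a 0 ⊎ ∃ λ k → a (suc k) ≡ x
  first-or-successor Sx with S⇒a Sx
  ... | zero  , refl = inj₁ refl
  ... | suc k , eq   = inj₂ (k , eq)

  none-between : ∀ k → NoneIn S (suc (a k)) (a (suc k))
  none-between k ak<x x<ak+1 Sx with S⇒a Sx
  ... | l , refl = <⇒≱ (increasing-cancel-< a-inc ak<x) (s≤s⁻¹ (increasing-cancel-< a-inc x<ak+1))

  previous-below : NoneIn S l (a (suc k)) → a k < l
  previous-below {k = k} none = ≰⇒> λ l≤ak → none l≤ak (a-inc k) (S-a k)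

  next-above : NoneIn S (suc (a k)) u → u ≤ a (suc k)
  next-above {k} none = ≮⇒≥ λ ak+1<u → none (a-inc k) ak+1<u (S-a (suc k))

  consecutive : T (S x) → T (S y) → x < y → NoneIn S (suc x) y → ∃ λ k → a k ≡ x × a (suc k) ≡ y
  consecutive Sx Sy x<y none with S⇒a Sx | S⇒a Sy
  ... | k , refl | l , refl = k , refl , cong a (≤-antisym k<l l≤1+k)
    where
    k<l = increasing-cancel-< a-inc x<y
    l≤1+k = increasing-cancel-≤ a-inc (next-above none)

  gapStart-a : t ≤ gap k → a k + t < N → GapStart S N t (a k)
  gapStart-a {t} {k} t≤gap ak+t<N =
    S-a k , NoneIn-⊆ ≤-refl (≤-trans (+-monoʳ-≤ (a k) t≤gap) (≤-reflexive (sym (a-suc k)))) (none-between k) , ak+t<N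

  empty-after⇔ : ∀ k r → NoneIn S (suc (a k)) (r + suc (a k)) ⇔ r < gap k
  empty-after⇔ k r = mk⇔ to from
    where
    swap-suc : r + suc (a k) ≡ a k + suc r
    swap-suc = trans (+-comm r (suc (a k))) (sym (+-suc (a k) r))
    to : NoneIn S (suc (a k)) (r + suc (a k)) → r < gap k
    to empty = +-cancelˡ-≤ (a k) (suc r) (gap k)
      (≤-trans (≤-reflexive (sym swap-suc)) (≤-trans (next-above empty) (≤-reflexive (a-suc k))))
    from : r < gap k → NoneIn S (suc (a k)) (r + suc (a k))
    from r<gap = NoneIn-⊆ ≤-refl
      (≤-trans (≤-reflexive swap-suc) (≤-trans (+-monoʳ-≤ (a k) r<gap) (≤-reflexive (sym (a-suc k)))))
      (none-between k)

  empty-before⇔ : ∀ k i → i + y ≡ a (suc k) → NoneIn S y (i + y) ⇔ i < gap k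
  empty-before⇔ {y} k i i+y≡ak+1 = mk⇔ to from
    where
    open ≤-Reasoning
    to : NoneIn S y (i + y) → i < gap k
    to empty = +-cancelˡ-< (a k) i (gap k) (begin-strict
      a k + i           <⟨ +-monoˡ-< i (previous-below (subst (NoneIn S y) i+y≡ak+1 empty)) ⟩
      y + i             ≡⟨ +-comm y i ⟩
      i + y             ≡⟨ trans i+y≡ak+1 (a-suc k) ⟩
      a k + gap k       ∎)
    from : i < gap k → NoneIn S y (i + y)
    from i<gap = NoneIn-⊆ (+-cancelʳ-< i (a k) y (begin-strict
      a k + i           <⟨ +-monoʳ-< (a k) i<gap ⟩
      a k + gap k       ≡⟨ sym (trans i+y≡ak+1 (a-suc k)) ⟩
      i + y             ≡⟨ +-comm i y ⟩
      y + i             ∎)) (≤-reflexive i+y≡ak+1) (none-between k)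

  -- a 0 is the exception because no gap precedes it.
  shiftEmbedding : ∀ i →
    (∀ {m} → GapStart χ′ n t m → T (S (i + m)) × (∀ {k} → a (suc k) ≡ i + m → t ≤ gap (suc k))) →
    GapStartEmbedding χ′ S n t
  shiftEmbedding {χ′} {n} {t} i lands = record
    { shift     = i
    ; exception = λ m → i + m ≡ᵇ a 0
    ; atMostOne = λ {x} {y} hx hy →
        +-cancelˡ-≡ i x y (trans (≡ᵇ⇒≡ (i + x) (a 0) hx) (sym (≡ᵇ⇒≡ (i + y) (a 0) hy)))
    ; embed     = embed
    }
    where
    embed : GapStart χ′ n t m → GapStart S (i + n) t (i + m) ⊎ T (i + m ≡ᵇ a 0)
    embed {m} g@(_ , _ , m+t<n) with lands g
    ... | S-im , wide with first-or-successor S-im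
    ... | inj₁ im≡a0      = inj₂ (≡⇒≡ᵇ (i + m) (a 0) im≡a0)
    ... | inj₂ (k , eq) = inj₁ (subst (GapStart S (i + n) t) eq (gapStart-a (wide eq)
      (subst (λ x → x + t < i + n) (sym eq) (≤-trans (≤-reflexive (cong suc (+-assoc i m t))) (+-monoʳ-< i m+t<n)))))

  allFalse-lands : 2 ≤ t → GapStart (matchesAt S (replicate s false)) n t m →
    T (S (s + m)) × (∀ {k} → a (suc k) ≡ s + m → t ≤ gap (suc k))
  allFalse-lands {t} {s} {n} {m} 2≤t g@(matched , _ , _) = S-end , wide
    where
    empty : NoneIn S m (s + m)
    empty = matchesAt-falses⁻ S s matched
    -- otherwise the pattern would also occur at m + 1, too close to m
    S-end : T (S (s + m))
    S-end = decidable-stable (T? (S (s + m))) λ ¬S-end →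
      let empty′ = NoneIn-⊆ (n≤1+n m) (≤-reflexive (+-suc s m)) (NoneIn-∷ʳ empty ¬S-end)
          m+t≤1+m = gapStart-reaches g (matchesAt-falses⁺ S s empty′) (n<1+n m)
      in <⇒≱ (+-monoʳ-< m 2≤t) (≤-trans m+t≤1+m (≤-reflexive (+-comm 1 m)))
    wide : a (suc k) ≡ s + m → t ≤ gap (suc k)
    wide {k} eq = ≤-trans t≤1+s s<gap′
      where
      s<gap : s < gap k
      s<gap = Equivalence.to (empty-before⇔ k s (sym eq)) empty
      s<gap′ : s < gap (suc k)
      s<gap′ = <-trans s<gap (gap-inc k)
      recurs : T (matchesAt S (replicate s false) (suc (s + m)))
      recurs = matchesAt-falses⁺ S s (subst (λ x → NoneIn S (suc x) (s + suc x)) eq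
        (Equivalence.from (empty-after⇔ (suc k) s) s<gap′))
      t≤1+s : t ≤ suc s
      t≤1+s = +-cancelˡ-≤ m t (suc s) (≤-trans (gapStart-reaches g recurs (s≤s (m≤n+m m s)))
        (≤-reflexive (trans (cong suc (+-comm s m)) (sym (+-suc m s)))))

  oneTrue-lands : GapStart (matchesAt S (replicate i false ++ true ∷ replicate r false)) n t m →
    T (S (i + m)) × (∀ {k} → a (suc k) ≡ i + m → t ≤ gap (suc k))
  oneTrue-lands {i} {r} {n} {t} {m} g@(matched , _ , _) with matchesAt-falses-++⁻ S i (true ∷ replicate r false) matched
  ... | empty-before , rest with matchesAt-true⁻ S (replicate r false) rest
  ... | S-im , rest′ = S-im , wide
    where
    empty-after : NoneIn S (suc (i + m)) (r + suc (i + m))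
    empty-after = matchesAt-falses⁻ S r rest′
    wide : a (suc k) ≡ i + m → t ≤ gap (suc k)
    wide {k} eq = +-cancelˡ-≤ m t δ (gapStart-reaches g recurs (m<m+n m (<-≤-trans z<s i<δ)))
      where
      δ = gap (suc k)
      i<δ : i < δ
      i<δ = <-trans (Equivalence.to (empty-before⇔ k i (sym eq)) empty-before) (gap-inc k)
      r<δ : r < δ
      r<δ = Equivalence.to (empty-after⇔ (suc k) r) (subst (λ x → NoneIn S (suc x) (r + suc x)) (sym eq) empty-after)
      lands-next : i + (m + δ) ≡ a (suc (suc k))
      lands-next = trans (sym (+-assoc i m δ)) (trans (cong (_+ δ) (sym eq)) (sym (a-suc (suc k))))
      recurs : T (matchesAt S (replicate i false ++ true ∷ replicate r false) (m + δ))
      recurs = matchesAt-falses-++⁺ S i (true ∷ replicate r false)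
        (Equivalence.from (empty-before⇔ (suc k) i lands-next) i<δ)
        (matchesAt-true⁺ S (replicate r false) (subst (T ∘ S) (sym lands-next) (S-a (suc (suc k))))
          (matchesAt-falses⁺ S r (subst (λ x → NoneIn S (suc x) (r + suc x)) (sym lands-next)
            (Equivalence.from (empty-after⇔ (suc (suc k)) r) (<-trans r<δ (gap-inc (suc k)))))))

  twoTrues-gap : ∀ i j w → T (matchesAt S (replicate i false ++ true ∷ replicate j false ++ true ∷ w) x) →
    ∃ λ k → a k ≡ i + x × gap k ≡ suc j
  twoTrues-gap {x} i j w matched with matchesAt-falses-++⁻ S i (true ∷ replicate j false ++ true ∷ w) matched
  ... | _ , rest with matchesAt-true⁻ S (replicate j false ++ true ∷ w) rest
  ... | S-first , rest′ with matchesAt-falses-++⁻ S j (true ∷ w) rest′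
  ... | empty , rest″ with consecutive S-first (proj₁ (matchesAt-true⁻ S w rest″)) (m≤n+m (suc (i + x)) j) empty
  ... | k , ak≡ , ak+1≡ = k , ak≡ , (begin
    a (suc k) ∸ a k                 ≡⟨ cong₂ _∸_ ak+1≡ ak≡ ⟩
    j + suc (i + x) ∸ (i + x)       ≡⟨ cong (_∸ (i + x)) (+-suc j (i + x)) ⟩
    suc j + (i + x) ∸ (i + x)       ≡⟨ m+n∸n≡m (suc j) (i + x) ⟩
    suc j                           ∎)
    where open ≡-Reasoning

  twoTrues-embedding : ∀ i j w →
    GapStartEmbedding (matchesAt S (replicate i false ++ true ∷ replicate j false ++ true ∷ w)) S n t
  twoTrues-embedding i j w = record
    { shift     = 0
    ; exception = matchesAt S (replicate i false ++ true ∷ replicate j false ++ true ∷ w)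
    ; atMostOne = atMostOne
    ; embed     = inj₂ ∘ proj₁
    }
    where
    atMostOne : AtMostOne (matchesAt S (replicate i false ++ true ∷ replicate j false ++ true ∷ w))
    atMostOne {x} {y} mx my with twoTrues-gap i j w mx | twoTrues-gap i j w my
    ... | k , ak≡ , gk | l , al≡ , gl = +-cancelˡ-≡ i x y
      (trans (sym ak≡) (trans (cong a (increasing-injective gap-inc (trans gk (sym gl)))) al≡))

  pattern-embedding : 2 ≤ t → ∀ w →
    Σ (GapStartEmbedding (matchesAt S w) S n t) λ E → GapStartEmbedding.shift E ≤ length w
  pattern-embedding 2≤t w with trues w
  ... | allFalse s     = shiftEmbedding s (allFalse-lands 2≤t) , ≤-reflexive (sym (length-replicate s))
  ... | oneTrue i r    = shiftEmbedding i oneTrue-lands ,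
    ≤-trans (m≤m+n i _) (≤-reflexive (sym (trans (length-++ (replicate i false)) (cong (_+ _) (length-replicate i)))))
  ... | twoTrues i j v = twoTrues-embedding i j v , z≤n

  γ-pattern : 2 ≤ t → ∀ w n → t * γ (matchesAt S w) n t ≤ t * γ S n t + (length w + 3 * t)
  γ-pattern {t} 2≤t w n with pattern-embedding {n = n} 2≤t w
  ... | E , shift≤length = ≤-trans (γ-embedding E) (+-monoʳ-≤ (t * γ S n t) (+-monoˡ-≤ (3 * t) shift≤length))

  pseudoloose⇒loose : Pseudoloose S → Loose S
  pseudoloose⇒loose (p , q , 1≤p , 1≤q , N , pseudo) =
    p , 2 * q , 1≤p , ≤-trans 1≤q (m≤m+n q (q + 0)) , N ⊔ C , loose
    where
    C = (8 * q) ^ q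
    loose : ∀ n → N ⊔ C < n → 1 ≤ n → LooseRel p (2 * q) S n
    loose n N⊔C<n 1≤n with pseudo n (m⊔n<o⇒m<o N C N⊔C<n) 1≤n
    ... | w , short , t , 1≤t , dense , lower , upper = t , 1≤t , dense′ , halve-window p q 1≤t 1≤n lower upper
      where
      C≤n^p : C ≤ n ^ p
      C≤n^p = ≤-trans (<⇒≤ (m⊔n<o⇒n<o N C N⊔C<n)) (m≤m^n p 1≤p 1≤n)
      small : ∀ x → x ^ q * n ^ p ≤ n ^ q → 8 * q * x ≤ n
      small x = ≤-from-exponents p q 1≤q C≤n^p
      1<n : 1 < n
      1<n = ≤-<-trans (1≤m^n q (≤-trans 1≤q (m≤n*m q 8))) (m⊔n<o⇒n<o N C N⊔C<n)
      2≤t : 2 ≤ t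
      2≤t = 2≤-from-exponents p q 1≤p 1<n lower
      error≤ : 2 * (q * (length w + 3 * t)) ≤ n
      error≤ = *-cancelˡ-≤ 4 (begin
        4 * (2 * (q * (length w + 3 * t)))   ≡⟨ spread q (length w) t ⟩
        8 * q * length w + 3 * (8 * q * t)   ≤⟨ +-mono-≤ (small (length w) short) (*-monoʳ-≤ 3 (small t upper)) ⟩
        n + 3 * n                            ≡⟨ collect n ⟩
        4 * n                                ∎)
        where
        open ≤-Reasoning
        spread : ∀ q s t → 4 * (2 * (q * (s + 3 * t))) ≡ 8 * q * s + 3 * (8 * q * t)
        spread = solve-∀
        collect : ∀ n → n + 3 * n ≡ 4 * n
        collect = solve-∀
      dense′ : p * n ≤ 2 * q * (t * γ S n t)
      dense′ = absorb-error {q = q} {X = t * γ S n t} {E = length w + 3 * t} 1≤p dense (γ-pattern 2≤t w n) error≤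

proposition3p15 : (a : ℕ → ℕ) →
    ((k : ℕ) → (a k < a (suc k)) × (a (suc k) ∸ a k < a (suc (suc k)) ∸ a (suc k))) →
    Pseudoloose (rangeχ a) ⇔ Loose (rangeχ a)
proposition3p15 a increasing = mk⇔ pseudoloose⇒loose (loose⇒pseudoloose (rangeχ a))
  where open IncreasingGaps a (proj₁ ∘ increasing) (proj₂ ∘ increasing)
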